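{- Let $\mathcal{L}$ be a conditional oriented matroid on a finite ground set $\mathcal{I}$, and let $i\in\mathcal{I}$ be an element that is not a coloop. Then $\pi$ restricts to bijections $\tau_+\to\tau''$ and $\tau_-\cup\tau_=\to\tau'$. In particular $|\tau|=|\tau'|+|\tau''|$.
   Context: Signed sets $X=(X^+,X^-)$ on $\mathcal{I}$ (disjoint subsets), $X_i\in\{+,-,0\}$ according as $i\in X^+$, $i\in X^-$, or neither; $-X=(X^-,X^+)$; $\operatorname{Sep}(X,Y)=\{j\mid X_j=-Y_j\ne0\}$; $(X\circ Y)_j=X_j$ if $X_j\ne0$, else $Y_j$. A conditional oriented matroid is a (possibly empty) set $\mathcal{L}$ of signed sets with (FS) $X,Y\in\mathcal{L}\Rightarrow X\circ-Y\in\mathcal{L}$ and (SE) for $X,Y\in\mathcal{L}$, $j\in\operatorname{Sep}(X,Y)$ there is $Z\in\mathcal{L}$ with $Z_j=0$ and $Z_k=(X\circ Y)_k$ for all $k\notin\operatorname{Sep}(X,Y)$. A coloop is an $i$ with $X_i=0$ for all $X\in\mathcal{L}$. For a signed set $X$ on $\mathcal{I}$, $\pi(X)$ is its restriction to $\mathcal{I}\setminus\{i\}$; for a signed set $X''$ on $\mathcal{I}\setminus\{i\}$, $\iota(X'')$ is its extension by $\iota(X'')_i=0$. Deletion: $\mathcal{L}'=\{\pi(X)\mid X\in\mathcal{L}\}$; contraction: $\mathcal{L}''=\{X''\mid\iota(X'')\in\mathcal{L}\}$. $\tau,\tau',\tau''$ are the sets of covectors of $\mathcal{L},\mathcal{L}',\mathcal{L}''$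 nonzero in every coordinate. $i$ is a wall of $X\in\tau$ if $\iota(\pi(X))\in\mathcal{L}$; $\tau_\pm=\{X\in\tau\mid i\text{ is a wall of }X,\ X_i=\pm\}$, $\tau_==\{X\in\tau\mid i\text{ is not a wall of }X\}$. -}

module Defs where

open import Data.Nat using (ℕ; zero; suc; _+_)
open import Data.Bool using (Bool; true; false; T; _∧_; _∨_; not; if_then_else_)
open import Data.Fin using (Fin)
open import Data.Vec using (Vec; []; _∷_; lookup; zipWith; map; insertAt; removeAt)
open import Data.Vec.Properties using (≡-dec)
open import Data.List using (List; []; _∷_; concatMap)
open import Data.Nat.ListAction using (sum)
open import Data.Bool.ListAction using (any)
import Data.List as List
open import Data.Product using (Σ; ∃; _×_; _,_)
open import Relation.Binary.PropositionalEquality using (_≡_; _≢_; refl)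
open import Relation.Nullary using (¬_; Dec; yes; no)
open import Relation.Nullary.Decidable using (⌊_⌋)

data Sign : Set where
  ⊕ ⊖ 𝟘 : Sign

_≟ˢ_ : (a b : Sign) → Dec (a ≡ b)
⊕ ≟ˢ ⊕ = yes refl
⊕ ≟ˢ ⊖ = no λ ()
⊕ ≟ˢ 𝟘 = no λ ()
⊖ ≟ˢ ⊕ = no λ ()
⊖ ≟ˢ ⊖ = yes refl
⊖ ≟ˢ 𝟘 = no λ ()
𝟘 ≟ˢ ⊕ = no λ ()
𝟘 ≟ˢ ⊖ = no λ ()
𝟘 ≟ˢ 𝟘 = yes refl

negˢ : Sign → Sign
negˢ ⊕ = ⊖
negˢ ⊖ = ⊕
negˢ 𝟘 = 𝟘

SignedSet : ℕ → Set
SignedSet m = Vec Sign m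

_≟ᵛ_ : ∀ {m} (X Y : SignedSet m) → Dec (X ≡ Y)
_≟ᵛ_ = ≡-dec _≟ˢ_

neg : ∀ {m} → SignedSet m → SignedSet m
neg = map negˢ

∘ˢ : Sign → Sign → Sign
∘ˢ 𝟘 y = y
∘ˢ x y = x

_∘ᵛ_ : ∀ {m} → SignedSet m → SignedSet m → SignedSet m
_∘ᵛ_ = zipWith ∘ˢ

InSep : ∀ {m} → SignedSet m → SignedSet m → Fin m → Set
InSep X Y j = (lookup X j ≡ negˢ (lookup Y j)) × (lookup X j ≢ 𝟘)

Family : ℕ → Set
Family m = SignedSet m → Bool

allSigned : (m : ℕ) → List (SignedSet m)
allSigned zero = [] ∷ []
allSigned (suc m) = concatMap (λ s → List.map (s ∷_) (allSigned m)) (⊕ ∷ ⊖ ∷ 𝟘 ∷ [])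

card : ∀ {m} → Family m → ℕ
card {m} P = sum (List.map (λ X → if P X then 1 else 0) (allSigned m))

IsCOM : ∀ {m} → Family m → Set
IsCOM L =
  (∀ X Y → T (L X) → T (L Y) → T (L (X ∘ᵛ neg Y)))
  × (∀ X Y j → T (L X) → T (L Y) → InSep X Y j →
       ∃ λ Z → T (L Z) × (lookup Z j ≡ 𝟘)
         × (∀ k → ¬ InSep X Y k → lookup Z k ≡ lookup (X ∘ᵛ Y) k))

IsColoop : ∀ {m} → Family m → Fin m → Set
IsColoop L i = ∀ X → T (L X) → lookup X i ≡ 𝟘

π : ∀ {n} → Fin (suc n) → SignedSet (suc n) → SignedSet n
π i X = removeAt X i

ι : ∀ {n} → Fin (suc n) → SignedSet n → SignedSet (suc n)
ι i X'' = insertAt X'' i 𝟘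

deletion : ∀ {n} → Family (suc n) → Fin (suc n) → Family n
deletion {n} L i Y = any (λ X → L X ∧ ⌊ π i X ≟ᵛ Y ⌋) (allSigned (suc n))

contraction : ∀ {n} → Family (suc n) → Fin (suc n) → Family n
contraction L i X'' = L (ι i X'')

nonzero : Sign → Bool
nonzero 𝟘 = false
nonzero _ = true

allNonzero : ∀ {m} → SignedSet m → Bool
allNonzero [] = true
allNonzero (x ∷ xs) = nonzero x ∧ allNonzero xs

topes : ∀ {m} → Family m → Family m
topes L X = L X ∧ allNonzero X

isWall : ∀ {n} → Family (suc n) → Fin (suc n) → SignedSet (suc n) → Bool
isWall L i X = L (ι i (π i X))

isSign : Sign → Sign → Bool
isSign a b = ⌊ a ≟ˢ b ⌋

τ₊ τ₋ τ₌ : ∀ {n} → Family (suc n) → Fin (suc n) → Family (suc n)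
τ₊ L i X = topes L X ∧ isWall L i X ∧ isSign (lookup X i) ⊕
τ₋ L i X = topes L X ∧ isWall L i X ∧ isSign (lookup X i) ⊖
τ₌ L i X = topes L X ∧ not (isWall L i X)

_∪ᶠ_ : ∀ {m} → Family m → Family m → Family m
(P ∪ᶠ Q) X = P X ∨ Q X

Elems : ∀ {m} → Family m → Set
Elems {m} P = Σ (SignedSet m) (λ X → T (P X))

{-# OPTIONS --safe #-}

-- For a tope A of the contraction, ι(A) is a covector; composing it with −Y, for a covector Y
-- with Y_i ≠ 0 (one exists as i is not a coloop), gives the extension of A by the sign −Y_i at i,
-- and composing once more gives the extension by Y_i.  So both extensions of A are topes having
-- i as a wall.  Conversely, if both extensions of A are covectors, strong elimination at i yields
-- a covector vanishing at i and equal to A elsewhere, namely ι(A).  Hence every fibre of π meets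
-- τ₊ in at most one tope, and does so exactly over τ''; likewise τ₋ ∪ τ₌ over τ'.  Summing over
-- the fibres of π gives the cardinalities.

module Submission where

open import Defs
open import Algebra.Properties.CommutativeSemigroup using (interchange)
open import Data.Bool using (Bool; true; false; T; _∧_; _∨_; not; if_then_else_)
open import Data.Bool.Properties using (T-irrelevant; T-∧; ∧-zeroʳ)
open import Data.Empty using (⊥; ⊥-elim)
open import Data.Fin using (Fin; zero; suc; punchIn)
open import Data.List using (List; []; _∷_; _++_)
import Data.List as List
open import Data.List.Membership.Propositional using (_∈_; lose)
open import Data.List.Membership.Propositional.Properties using (∈-map⁺; ∈-++⁺ˡ; ∈-++⁺ʳ)
open import Data.List.Properties using (map-++; map-∘; map-cong)
open import Data.List.Relation.Unary.Any using (here; satisfied)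
open import Data.List.Relation.Unary.Any.Properties using (any⁺; any⁻)
open import Data.Nat using (ℕ; suc; _+_)
open import Data.Nat.ListAction using (sum)
open import Data.Nat.ListAction.Properties using (sum-++)
open import Data.Nat.Properties using (+-comm; +-identityʳ; +-commutativeSemigroup)
open import Data.Product using (Σ; ∃; _×_; _,_; proj₁; proj₂)
open import Data.Sum using (_⊎_; inj₁; inj₂)
open import Data.Unit using (tt)
open import Data.Vec using ([]; _∷_; lookup; insertAt; removeAt)
open import Data.Vec.Properties
  using (insertAt-lookup; insertAt-punchIn; removeAt-insertAt; insertAt-removeAt;
         lookup-map; lookup-zipWith)
open import Function using (_∘_)
open import Function.Bundles using (_⤖_; Bijection; mk⤖; Equivalence)
open import Relation.Binary.PropositionalEquality
  using (_≡_; _≢_; refl; sym; trans; cong; cong₂; subst; module ≡-Reasoning)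
open import Relation.Nullary using (¬_; yes; no)
open import Relation.Nullary.Decidable using (⌊_⌋; toWitness; fromWitness)

private
  variable
    m n : ℕ
    s t : Sign
    A : SignedSet n

negˢ-involutive : ∀ s → negˢ (negˢ s) ≡ s
negˢ-involutive ⊕ = refl
negˢ-involutive ⊖ = refl
negˢ-involutive 𝟘 = refl

≡negˢ⇒≡𝟘 : s ≡ negˢ s → s ≡ 𝟘
≡negˢ⇒≡𝟘 {𝟘} _ = refl

∘ˢ-idem : ∀ s → ∘ˢ s s ≡ s
∘ˢ-idem ⊕ = refl
∘ˢ-idem ⊖ = refl
∘ˢ-idem 𝟘 = refl

≢𝟘⇒≡⊎≡negˢ : s ≢ 𝟘 → t ≢ 𝟘 → s ≡ t ⊎ s ≡ negˢ t
≢𝟘⇒≡⊎≡negˢ {⊕} {⊕} _ _ = inj₁ refl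
≢𝟘⇒≡⊎≡negˢ {⊕} {⊖} _ _ = inj₂ refl
≢𝟘⇒≡⊎≡negˢ {⊖} {⊕} _ _ = inj₂ refl
≢𝟘⇒≡⊎≡negˢ {⊖} {⊖} _ _ = inj₁ refl
≢𝟘⇒≡⊎≡negˢ {𝟘} s≢𝟘 _ = ⊥-elim (s≢𝟘 refl)
≢𝟘⇒≡⊎≡negˢ {_} {𝟘} _ t≢𝟘 = ⊥-elim (t≢𝟘 refl)

≢𝟘⇒nonzero : s ≢ 𝟘 → T (nonzero s)
≢𝟘⇒nonzero {⊕} _ = tt
≢𝟘⇒nonzero {⊖} _ = tt
≢𝟘⇒nonzero {𝟘} s≢𝟘 = s≢𝟘 refl

isSign⁺ : s ≡ t → T (isSign s t)
isSign⁺ {s} {t} = fromWitness {a? = s ≟ˢ t}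

isSign⁻ : T (isSign s t) → s ≡ t
isSign⁻ = toWitness

allNonzero-lookup : ∀ (A : SignedSet n) j → T (allNonzero A) → lookup A j ≢ 𝟘
allNonzero-lookup (⊕ ∷ A) zero _ ()
allNonzero-lookup (⊖ ∷ A) zero _ ()
allNonzero-lookup (⊕ ∷ A) (suc j) nz = allNonzero-lookup A j nz
allNonzero-lookup (⊖ ∷ A) (suc j) nz = allNonzero-lookup A j nz

allNonzero-insertAt : ∀ (A : SignedSet n) i s → allNonzero (insertAt A i s) ≡ nonzero s ∧ allNonzero A
allNonzero-insertAt A zero s = refl
allNonzero-insertAt (⊕ ∷ A) (suc i) s = allNonzero-insertAt A i s
allNonzero-insertAt (⊖ ∷ A) (suc i) s = allNonzero-insertAt A i s
allNonzero-insertAt (𝟘 ∷ A) (suc i) s = sym (∧-zeroʳ (nonzero s))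

allNonzero-insertAt⁺ : ∀ i → s ≢ 𝟘 → T (allNonzero A) → T (allNonzero (insertAt A i s))
allNonzero-insertAt⁺ {s = s} {A = A} i s≢𝟘 nz =
  subst T (sym (allNonzero-insertAt A i s)) (Equivalence.from T-∧ (≢𝟘⇒nonzero s≢𝟘 , nz))

allNonzero-insertAt⁻ : ∀ i → T (allNonzero (insertAt A i s)) → T (allNonzero A)
allNonzero-insertAt⁻ {A = A} {s = s} i nz =
  proj₂ (Equivalence.to T-∧ (subst T (allNonzero-insertAt A i s) nz))

allNonzero-removeAt : ∀ (X : SignedSet (suc n)) i → T (allNonzero X) → T (allNonzero (removeAt X i))
allNonzero-removeAt X i nz =
  allNonzero-insertAt⁻ i (subst (T ∘ allNonzero) (sym (insertAt-removeAt X i)) nz)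

allNonzero-removeAt⁻ : ∀ (X : SignedSet (suc n)) i →
                       lookup X i ≢ 𝟘 → T (allNonzero (removeAt X i)) → T (allNonzero X)
allNonzero-removeAt⁻ X i Xᵢ≢𝟘 nz =
  subst (T ∘ allNonzero) (insertAt-removeAt X i) (allNonzero-insertAt⁺ i Xᵢ≢𝟘 nz)

insertAt-removeAt′ : ∀ (X : SignedSet (suc n)) i → lookup X i ≡ s → insertAt (removeAt X i) i s ≡ X
insertAt-removeAt′ X i Xᵢ = trans (cong (insertAt (removeAt X i) i) (sym Xᵢ)) (insertAt-removeAt X i)

removeAt-lookup-injective : ∀ (X Y : SignedSet (suc n)) i →
                            lookup X i ≡ lookup Y i → removeAt X i ≡ removeAt Y i → X ≡ Y
removeAt-lookup-injective X Y i eᵢ e = begin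
  X                                        ≡⟨ insertAt-removeAt X i ⟨
  insertAt (removeAt X i) i (lookup X i)   ≡⟨ cong₂ (λ B s → insertAt B i s) e eᵢ ⟩
  insertAt (removeAt Y i) i (lookup Y i)   ≡⟨ insertAt-removeAt Y i ⟩
  Y                                        ∎
  where open ≡-Reasoning

insertAt-unique : ∀ (Z : SignedSet (suc n)) (A : SignedSet n) i →
                  (∀ j → lookup Z (punchIn i j) ≡ lookup A j) → lookup Z i ≡ s → Z ≡ insertAt A i s
insertAt-unique (z ∷ Z) A zero Z≗A refl = cong (z ∷_) (lookup-ext Z A Z≗A)
  where
  lookup-ext : ∀ (X Y : SignedSet n) → (∀ j → lookup X j ≡ lookup Y j) → X ≡ Y
  lookup-ext [] [] _ = refl
  lookup-ext (x ∷ X) (y ∷ Y) X≗Y = cong₂ _∷_ (X≗Y zero) (lookup-ext X Y (X≗Y ∘ suc))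
insertAt-unique (z ∷ Z) (a ∷ A) (suc i) Z≗A Zᵢ≡s =
  cong₂ _∷_ (Z≗A zero) (insertAt-unique Z A i (Z≗A ∘ suc) Zᵢ≡s)

∘ᵛ-allNonzero : ∀ (A B : SignedSet n) → T (allNonzero A) → A ∘ᵛ B ≡ A
∘ᵛ-allNonzero [] [] _ = refl
∘ᵛ-allNonzero (⊕ ∷ A) (_ ∷ B) nz = cong (⊕ ∷_) (∘ᵛ-allNonzero A B nz)
∘ᵛ-allNonzero (⊖ ∷ A) (_ ∷ B) nz = cong (⊖ ∷_) (∘ᵛ-allNonzero A B nz)

insertAt-𝟘-∘ᵛ : ∀ (A : SignedSet n) i (B : SignedSet (suc n)) → T (allNonzero A) →
                insertAt A i 𝟘 ∘ᵛ B ≡ insertAt A i (lookup B i)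
insertAt-𝟘-∘ᵛ A zero (b ∷ B) nz = cong (b ∷_) (∘ᵛ-allNonzero A B nz)
insertAt-𝟘-∘ᵛ (⊕ ∷ A) (suc i) (b ∷ B) nz = cong (⊕ ∷_) (insertAt-𝟘-∘ᵛ A i B nz)
insertAt-𝟘-∘ᵛ (⊖ ∷ A) (suc i) (b ∷ B) nz = cong (⊖ ∷_) (insertAt-𝟘-∘ᵛ A i B nz)

ind : Bool → ℕ
ind b = if b then 1 else 0

ind-cong : ∀ {a b} → (T a → T b) → (T b → T a) → ind a ≡ ind b
ind-cong {false} {false} _ _ = refl
ind-cong {false} {true} _ b⇒a = ⊥-elim (b⇒a tt)
ind-cong {true} {false} a⇒b _ = ⊥-elim (a⇒b tt)
ind-cong {true} {true} _ _ = refl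

Σˢ : ∀ m → (SignedSet m → ℕ) → ℕ
Σˢ m g = sum (List.map g (allSigned m))

Σsign : (Sign → ℕ) → ℕ
Σsign h = h ⊕ + (h ⊖ + h 𝟘)

Σsign-cong : ∀ {h h′ : Sign → ℕ} → (∀ s → h s ≡ h′ s) → Σsign h ≡ Σsign h′
Σsign-cong h≗h′ = cong₂ _+_ (h≗h′ ⊕) (cong₂ _+_ (h≗h′ ⊖) (h≗h′ 𝟘))

Σsign-isSign : ∀ s → Σsign (λ t → ind (isSign t s)) ≡ 1
Σsign-isSign ⊕ = refl
Σsign-isSign ⊖ = refl
Σsign-isSign 𝟘 = refl

sum-map-+ : ∀ {X : Set} (g h : X → ℕ) xs →
            sum (List.map (λ x → g x + h x) xs) ≡ sum (List.map g xs) + sum (List.map h xs)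
sum-map-+ g h [] = refl
sum-map-+ g h (x ∷ xs) = trans (cong (g x + h x +_) (sum-map-+ g h xs))
                               (interchange +-commutativeSemigroup (g x) (h x) _ _)

Σˢ-cong : ∀ {g h : SignedSet m → ℕ} → (∀ X → g X ≡ h X) → Σˢ m g ≡ Σˢ m h
Σˢ-cong {m} g≗h = cong sum (map-cong g≗h (allSigned m))

Σˢ-+ : ∀ (g h : SignedSet m → ℕ) → Σˢ m (λ X → g X + h X) ≡ Σˢ m g + Σˢ m h
Σˢ-+ {m} g h = sum-map-+ g h (allSigned m)

Σsign-Σˢ : ∀ (h : Sign → SignedSet n → ℕ) → Σsign (λ s → Σˢ n (h s)) ≡ Σˢ n (λ Y → Σsign (λ s → h s Y))
Σsign-Σˢ h = sym (trans (Σˢ-+ (h ⊕) _) (cong (Σˢ _ (h ⊕) +_) (Σˢ-+ (h ⊖) (h 𝟘))))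

Σˢ-∷ : ∀ (g : SignedSet (suc n) → ℕ) → Σˢ (suc n) g ≡ Σsign (λ s → Σˢ n (g ∘ (s ∷_)))
Σˢ-∷ {n} g = begin
  Σ-over (⊕s ++ (⊖s ++ (𝟘s ++ [])))             ≡⟨ sum-map-++ ⊕s _ ⟩
  Σ-over ⊕s + Σ-over (⊖s ++ (𝟘s ++ []))         ≡⟨ cong (Σ-over ⊕s +_) (sum-map-++ ⊖s _) ⟩
  Σ-over ⊕s + (Σ-over ⊖s + Σ-over (𝟘s ++ []))   ≡⟨ cong (third-summand ⊕s ⊖s) (sum-map-++ 𝟘s []) ⟩
  Σ-over ⊕s + (Σ-over ⊖s + (Σ-over 𝟘s + 0))     ≡⟨ cong (third-summand ⊕s ⊖s) (+-identityʳ _) ⟩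
  Σsign (λ s → Σ-over (List.map (s ∷_) (allSigned n)))
    ≡⟨ Σsign-cong (λ s → cong sum (sym (map-∘ {g = g} {f = s ∷_} (allSigned n)))) ⟩
  Σsign (λ s → Σˢ n (g ∘ (s ∷_)))               ∎
  where
  open ≡-Reasoning
  ⊕s ⊖s 𝟘s : List (SignedSet (suc n))
  ⊕s = List.map (⊕ ∷_) (allSigned n)
  ⊖s = List.map (⊖ ∷_) (allSigned n)
  𝟘s = List.map (𝟘 ∷_) (allSigned n)
  Σ-over : List (SignedSet (suc n)) → ℕ
  Σ-over xs = sum (List.map g xs)
  sum-map-++ : ∀ xs ys → Σ-over (xs ++ ys) ≡ Σ-over xs + Σ-over ys
  sum-map-++ xs ys = trans (cong sum (map-++ g xs ys)) (sum-++ (List.map g xs) _)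
  third-summand : List (SignedSet (suc n)) → List (SignedSet (suc n)) → ℕ → ℕ
  third-summand xs ys k = Σ-over xs + (Σ-over ys + k)

Σˢ-insertAt : ∀ i (g : SignedSet (suc n) → ℕ) →
              Σˢ (suc n) g ≡ Σˢ n (λ Y → Σsign (λ s → g (insertAt Y i s)))
Σˢ-insertAt zero g = trans (Σˢ-∷ g) (Σsign-Σˢ (λ s Y → g (s ∷ Y)))
Σˢ-insertAt {suc n} (suc i) g = begin
  Σˢ (suc (suc n)) g                                                ≡⟨ Σˢ-∷ g ⟩
  Σsign (λ s → Σˢ (suc n) (g ∘ (s ∷_)))                             ≡⟨ Σsign-cong (λ s → Σˢ-insertAt i (g ∘ (s ∷_))) ⟩
  Σsign (λ s → Σˢ n (λ Y → Σsign (λ t → g (s ∷ insertAt Y i t))))  ≡⟨ Σˢ-∷ fibres ⟨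
  Σˢ (suc n) fibres                                                 ∎
  where
  open ≡-Reasoning
  fibres : SignedSet (suc n) → ℕ
  fibres Y = Σsign (λ t → g (insertAt Y (suc i) t))

card-split : ∀ (P Q R : Family m) → (∀ X → ind (P X) ≡ ind (Q X) + ind (R X)) →
             card P ≡ card Q + card R
card-split P Q R split = trans (Σˢ-cong split) (Σˢ-+ (ind ∘ Q) (ind ∘ R))

Elems-≡ : ∀ {P : Family m} {x y : Elems P} → proj₁ x ≡ proj₁ y → x ≡ y
Elems-≡ {x = X , p} {y = .X , q} refl = cong (X ,_) (T-irrelevant p q)

record IsπBijection (i : Fin (suc n)) (P : Family (suc n)) (Q : Family n) : Set where
  field
    π-maps : ∀ {X} → T (P X) → T (Q (π i X))
    π-injective : ∀ {X Y} → T (P X) → T (P Y) → π i X ≡ π i Y → X ≡ Y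
    π-surjective : ∀ {Y} → T (Q Y) → ∃ λ X → T (P X) × π i X ≡ Y

  bijection : Σ (Elems P ⤖ Elems Q) (λ f → ∀ x → proj₁ (Bijection.to f x) ≡ π i (proj₁ x))
  bijection = mk⤖ {to = to} (injective , surjective) , λ _ → refl
    where
    to : Elems P → Elems Q
    to (X , p) = π i X , π-maps p
    injective : ∀ {x y} → to x ≡ to y → x ≡ y
    injective {_ , p} {_ , q} e = Elems-≡ (π-injective p q (cong proj₁ e))
    surjective : ∀ y → ∃ λ x → ∀ {z} → z ≡ x → to z ≡ y
    surjective (Y , q) with π-surjective q
    ... | X , p , refl = (X , p) , λ { refl → Elems-≡ refl }

  fibre-size : ∀ Y → Σsign (λ s → ind (P (insertAt Y i s))) ≡ ind (Q Y)
  fibre-size Y with Q Y in Q[Y]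
  ... | false = Σsign-cong λ s → ind-cong (λ p → subst T Q[Y] (Q-over {s} p)) λ ()
    where
    Q-over : ∀ {s} → T (P (insertAt Y i s)) → T (Q Y)
    Q-over {s} p = subst (T ∘ Q) (removeAt-insertAt Y i s) (π-maps p)
  ... | true with π-surjective (subst T (sym Q[Y]) tt)
  ...   | X , p , refl =
    trans (Σsign-cong λ s → ind-cong (over⇒sign s) (sign⇒over s)) (Σsign-isSign (lookup X i))
    where
    over⇒sign : ∀ s → T (P (insertAt (π i X) i s)) → T (isSign s (lookup X i))
    over⇒sign s q = isSign⁺ (begin
      s                                ≡⟨ insertAt-lookup (π i X) i s ⟨
      lookup (insertAt (π i X) i s) i  ≡⟨ cong (λ Z → lookup Z i) (π-injective q p (removeAt-insertAt (π i X) i s)) ⟩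
      lookup X i                       ∎)
      where open ≡-Reasoning
    sign⇒over : ∀ s → T (isSign s (lookup X i)) → T (P (insertAt (π i X) i s))
    sign⇒over s e = subst (T ∘ P) (sym (insertAt-removeAt′ X i (sym (isSign⁻ e)))) p

  card≡ : card P ≡ card Q
  card≡ = trans (Σˢ-insertAt i (ind ∘ P)) (Σˢ-cong fibre-size)

tope⁺ : ∀ (P : Family m) {X} → T (P X) → T (allNonzero X) → T (topes P X)
tope⁺ _ p nz = Equivalence.from T-∧ (p , nz)

tope⁻ : ∀ (P : Family m) {X} → T (topes P X) → T (P X) × T (allNonzero X)
tope⁻ _ = Equivalence.to T-∧

allSigned-complete : ∀ (X : SignedSet m) → X ∈ allSigned m
allSigned-complete [] = here refl
allSigned-complete {suc m} (⊕ ∷ X) = ∈-++⁺ˡ (∈-map⁺ (⊕ ∷_) (allSigned-complete X))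
allSigned-complete {suc m} (⊖ ∷ X) =
  ∈-++⁺ʳ (List.map (⊕ ∷_) (allSigned m)) (∈-++⁺ˡ (∈-map⁺ (⊖ ∷_) (allSigned-complete X)))
allSigned-complete {suc m} (𝟘 ∷ X) =
  ∈-++⁺ʳ (List.map (⊕ ∷_) (allSigned m))
    (∈-++⁺ʳ (List.map (⊖ ∷_) (allSigned m)) (∈-++⁺ˡ (∈-map⁺ (𝟘 ∷_) (allSigned-complete X))))

module _ (L : Family (suc n)) (i : Fin (suc n)) where

  τ₋∪τ₌ : Family (suc n)
  τ₋∪τ₌ = τ₋ L i ∪ᶠ τ₌ L i

  deletion⁺ : ∀ {X} → T (L X) → T (deletion L i (π i X))
  deletion⁺ {X} l =
    any⁺ _ (lose (allSigned-complete X) (Equivalence.from T-∧ (l , fromWitness {a? = π i X ≟ᵛ π i X} refl)))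

  deletion⁻ : ∀ {Y} → T (deletion L i Y) → ∃ λ X → T (L X) × π i X ≡ Y
  deletion⁻ {Y} d with satisfied (any⁻ (λ X → L X ∧ ⌊ π i X ≟ᵛ Y ⌋) (allSigned (suc n)) d)
  ... | X , q with Equivalence.to T-∧ q
  ...   | l , e = X , l , toWitness e

  τ₊⁻ : ∀ {X} → T (τ₊ L i X) → T (topes L X) × T (isWall L i X) × lookup X i ≡ ⊕
  τ₊⁻ p with Equivalence.to T-∧ p
  ... | t , q with Equivalence.to T-∧ q
  ...   | w , s = t , w , isSign⁻ s

  τ₋∪τ₌⇒tope : ∀ X → T (τ₋∪τ₌ X) → T (topes L X)
  τ₋∪τ₌⇒tope X u with topes L X
  ... | true = tt
  ... | false = u

  τ₋∪τ₌-⊖ : ∀ X → T (topes L X) → lookup X i ≡ ⊖ → T (τ₋∪τ₌ X)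
  τ₋∪τ₌-⊖ X t Xᵢ with lookup X i | Xᵢ
  ... | ⊖ | refl with topes L X | isWall L i X
  ...   | true | true = tt
  ...   | true | false = tt
  ...   | false | _ = t

  τ₋∪τ₌-nonwall : ∀ X → T (topes L X) → isWall L i X ≡ false → T (τ₋∪τ₌ X)
  τ₋∪τ₌-nonwall X t w with isWall L i X | w
  ... | false | refl with topes L X
  ...   | true = tt
  ...   | false = t

  τ₋∪τ₌-⊕⇒nonwall : ∀ X → T (τ₋∪τ₌ X) → lookup X i ≡ ⊕ → isWall L i X ≡ false
  τ₋∪τ₌-⊕⇒nonwall X u Xᵢ with lookup X i | Xᵢ
  ... | ⊕ | refl with topes L X | isWall L i X
  ...   | true | false = refl
  ...   | true | true = ⊥-elim u
  ...   | false | _ = ⊥-elim u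

  ind-tope-split : ∀ X → ind (topes L X) ≡ ind (τ₊ L i X) + ind (τ₋∪τ₌ X)
  ind-tope-split X = split (topes L X) (isWall L i X) (lookup X i)
                           (allNonzero-lookup X i ∘ proj₂ ∘ tope⁻ L)
    where
    split : ∀ t w a → (T t → a ≢ 𝟘) →
            ind t ≡ ind (t ∧ w ∧ isSign a ⊕) + ind ((t ∧ w ∧ isSign a ⊖) ∨ (t ∧ not w))
    split false _ _ _ = refl
    split true true ⊕ _ = refl
    split true true ⊖ _ = refl
    split true false ⊕ _ = refl
    split true false ⊖ _ = refl
    split true _ 𝟘 a≢𝟘 = ⊥-elim (a≢𝟘 tt refl)

  private
    _↑_ : SignedSet n → Sign → SignedSet (suc n)
    A ↑ s = insertAt A i s

  module _ (com : IsCOM L) where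

    composition-↑ : ∀ {A Y} → T (allNonzero A) → T (L (A ↑ 𝟘)) → T (L Y) → T (L (A ↑ negˢ (lookup Y i)))
    composition-↑ {A} {Y} nz a y =
      subst (T ∘ L) (trans (insertAt-𝟘-∘ᵛ A i (neg Y) nz) (cong (A ↑_) (lookup-map i negˢ Y)))
            (proj₁ com _ _ a y)

    ↑-both-signs : ∀ {A Y} → T (allNonzero A) → T (L (A ↑ 𝟘)) → T (L Y) →
                   T (L (A ↑ lookup Y i)) × T (L (A ↑ negˢ (lookup Y i)))
    ↑-both-signs {A} {Y} nz a y = subst (λ s → T (L (A ↑ s))) flip-twice (composition-↑ nz a y⁻) , y⁻
      where
      y⁻ = composition-↑ nz a y
      flip-twice : negˢ (lookup (A ↑ negˢ (lookup Y i)) i) ≡ lookup Y i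
      flip-twice = trans (cong negˢ (insertAt-lookup A i _)) (negˢ-involutive _)

    ↑-elimination : ∀ A → T (L (A ↑ ⊕)) → T (L (A ↑ ⊖)) → T (L (A ↑ 𝟘))
    ↑-elimination A p q with proj₂ com (A ↑ ⊕) (A ↑ ⊖) i p q sep-i
      where
      sep-i : InSep (A ↑ ⊕) (A ↑ ⊖) i
      sep-i = trans (insertAt-lookup A i ⊕) (cong negˢ (sym (insertAt-lookup A i ⊖)))
            , subst (_≢ 𝟘) (sym (insertAt-lookup A i ⊕)) (λ ())
    ... | Z , z , Zᵢ≡𝟘 , agree = subst (T ∘ L) (insertAt-unique Z A i Z≗A Zᵢ≡𝟘) z
      where
      ⊕≗⊖ : ∀ j → lookup (A ↑ ⊕) (punchIn i j) ≡ lookup (A ↑ ⊖) (punchIn i j)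
      ⊕≗⊖ j = trans (insertAt-punchIn A i ⊕ j) (sym (insertAt-punchIn A i ⊖ j))
      -- the two extensions of A agree off i, so no coordinate other than i separates them
      Z≗A : ∀ j → lookup Z (punchIn i j) ≡ lookup A j
      Z≗A j = begin
        lookup Z k                         ≡⟨ agree k not-sep ⟩
        lookup ((A ↑ ⊕) ∘ᵛ (A ↑ ⊖)) k      ≡⟨ lookup-zipWith ∘ˢ k (A ↑ ⊕) (A ↑ ⊖) ⟩
        ∘ˢ (lookup (A ↑ ⊕) k) (lookup (A ↑ ⊖) k)  ≡⟨ cong (λ s → ∘ˢ s (lookup (A ↑ ⊖) k)) (⊕≗⊖ j) ⟩
        ∘ˢ (lookup (A ↑ ⊖) k) (lookup (A ↑ ⊖) k)  ≡⟨ ∘ˢ-idem _ ⟩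
        lookup (A ↑ ⊖) k                   ≡⟨ insertAt-punchIn A i ⊖ j ⟩
        lookup A j                         ∎
        where
        open ≡-Reasoning
        k = punchIn i j
        not-sep : ¬ InSep (A ↑ ⊕) (A ↑ ⊖) (punchIn i j)
        not-sep (e , ≢𝟘) = ≢𝟘 (trans (⊕≗⊖ j) (≡negˢ⇒≡𝟘 (trans (sym (⊕≗⊖ j)) e)))

    module _ (noncoloop : ¬ IsColoop L i) where

      ↑-nonzero : ∀ {A s} → T (allNonzero A) → T (L (A ↑ 𝟘)) → s ≢ 𝟘 → T (L (A ↑ s))
      ↑-nonzero {A} {s} nz a s≢𝟘 with L (A ↑ s) in L[A↑s]
      ... | true = tt
      ... | false = noncoloop coloop
        where
        coloop : IsColoop L i
        coloop Y y with lookup Y i ≟ˢ 𝟘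
        ... | yes Yᵢ≡𝟘 = Yᵢ≡𝟘
        ... | no Yᵢ≢𝟘 = ⊥-elim (subst T L[A↑s] A↑s∈L)
          where
          A↑s∈L : T (L (A ↑ s))
          A↑s∈L with ≢𝟘⇒≡⊎≡negˢ s≢𝟘 Yᵢ≢𝟘 | ↑-both-signs nz a y
          ... | inj₁ s≡ | l , _ = subst (λ t → T (L (A ↑ t))) (sym s≡) l
          ... | inj₂ s≡ | _ , l = subst (λ t → T (L (A ↑ t))) (sym s≡) l

      ↑-tope : ∀ {Y s} → T (topes (contraction L i) Y) → s ≢ 𝟘 → T (topes L (Y ↑ s))
      ↑-tope {Y} q s≢𝟘 with tope⁻ (contraction L i) q
      ... | a , nz = tope⁺ L (↑-nonzero nz a s≢𝟘) (allNonzero-insertAt⁺ i s≢𝟘 nz)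

      τ₊-bijection : IsπBijection i (τ₊ L i) (topes (contraction L i))
      τ₊-bijection = record
        { π-maps = λ {X} p → let t , w , _ = τ₊⁻ p in
                               tope⁺ (contraction L i) w (allNonzero-removeAt X i (proj₂ (tope⁻ L t)))
        ; π-injective = λ {X} {Y} p q → removeAt-lookup-injective X Y i (trans (sign p) (sym (sign q)))
        ; π-surjective = λ {Y} q → Y ↑ ⊕ , preimage q , removeAt-insertAt Y i ⊕
        }
        where
        sign : ∀ {X} → T (τ₊ L i X) → lookup X i ≡ ⊕
        sign p = proj₂ (proj₂ (τ₊⁻ p))
        preimage : ∀ {Y} → T (topes (contraction L i) Y) → T (τ₊ L i (Y ↑ ⊕))
        preimage {Y} q =
          Equivalence.from T-∧ (↑-tope q (λ ()) , Equivalence.from T-∧ (wall , isSign⁺ (insertAt-lookup Y i ⊕)))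
          where
          wall : T (L (ι i (π i (Y ↑ ⊕))))
          wall = subst (λ B → T (L (ι i B))) (sym (removeAt-insertAt Y i ⊕))
                       (proj₁ (tope⁻ (contraction L i) q))

      τ₋∪τ₌-sign≢𝟘 : ∀ {Z} → T (τ₋∪τ₌ Z) → lookup Z i ≢ 𝟘
      τ₋∪τ₌-sign≢𝟘 {Z} u = allNonzero-lookup Z i (proj₂ (tope⁻ L (τ₋∪τ₌⇒tope Z u)))

      τ₋∪τ₌-not-opposite : ∀ {X Y} → T (τ₋∪τ₌ X) → T (τ₋∪τ₌ Y) →
                           π i X ≡ π i Y → lookup X i ≡ ⊕ → lookup Y i ≡ ⊖ → ⊥
      τ₋∪τ₌-not-opposite {X} {Y} u v e Xᵢ Yᵢ =
        subst T (τ₋∪τ₌-⊕⇒nonwall X u Xᵢ)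
                (↑-elimination (π i X) (covector X u Xᵢ refl) (covector Y v Yᵢ (sym e)))
        where
        covector : ∀ {s} Z → T (τ₋∪τ₌ Z) → lookup Z i ≡ s → π i Z ≡ π i X → T (L (π i X ↑ s))
        covector {s} Z w Zᵢ πZ =
          subst (T ∘ L) (sym (trans (cong (_↑ s) (sym πZ)) (insertAt-removeAt′ Z i Zᵢ)))
                (proj₁ (tope⁻ L (τ₋∪τ₌⇒tope Z w)))

      τ₋∪τ₌-same-sign : ∀ {X Y} → T (τ₋∪τ₌ X) → T (τ₋∪τ₌ Y) →
                        π i X ≡ π i Y → lookup X i ≡ lookup Y i
      τ₋∪τ₌-same-sign {X} {Y} u v e = by-signs (lookup X i) (lookup Y i) refl refl
        where
        by-signs : ∀ a b → lookup X i ≡ a → lookup Y i ≡ b → lookup X i ≡ lookup Y i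
        by-signs ⊕ ⊕ Xᵢ Yᵢ = trans Xᵢ (sym Yᵢ)
        by-signs ⊖ ⊖ Xᵢ Yᵢ = trans Xᵢ (sym Yᵢ)
        by-signs ⊕ ⊖ Xᵢ Yᵢ = ⊥-elim (τ₋∪τ₌-not-opposite u v e Xᵢ Yᵢ)
        by-signs ⊖ ⊕ Xᵢ Yᵢ = ⊥-elim (τ₋∪τ₌-not-opposite v u (sym e) Yᵢ Xᵢ)
        by-signs 𝟘 _ Xᵢ _ = ⊥-elim (τ₋∪τ₌-sign≢𝟘 u Xᵢ)
        by-signs _ 𝟘 _ Yᵢ = ⊥-elim (τ₋∪τ₌-sign≢𝟘 v Yᵢ)

      τ₋∪τ₌-bijection : IsπBijection i τ₋∪τ₌ (topes (deletion L i))
      τ₋∪τ₌-bijection = record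
        { π-maps = λ {X} u → let l , nz = tope⁻ L (τ₋∪τ₌⇒tope X u) in
                               tope⁺ (deletion L i) (deletion⁺ l) (allNonzero-removeAt X i nz)
        ; π-injective = λ {X} {Y} u v e → removeAt-lookup-injective X Y i (τ₋∪τ₌-same-sign u v e) e
        ; π-surjective = surjective
        }
        where
        tope-over : ∀ X → T (L X) → T (allNonzero (π i X)) → lookup X i ≢ 𝟘 → T (topes L X)
        tope-over X l nz Xᵢ≢𝟘 = tope⁺ L l (allNonzero-removeAt⁻ X i Xᵢ≢𝟘 nz)
        ↑⊖-preimage : ∀ {Y} → T (allNonzero Y) → T (L (Y ↑ 𝟘)) →
                      ∃ λ X → T (τ₋∪τ₌ X) × π i X ≡ Y
        ↑⊖-preimage {Y} nz a =
          Y ↑ ⊖ , τ₋∪τ₌-⊖ (Y ↑ ⊖) (↑-tope (tope⁺ (contraction L i) a nz) (λ ())) (insertAt-lookup Y i ⊖)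
                , removeAt-insertAt Y i ⊖
        preimage-over : ∀ X → T (L X) → T (allNonzero (π i X)) → ∃ λ Z → T (τ₋∪τ₌ Z) × π i Z ≡ π i X
        preimage-over X l nz with lookup X i in Xᵢ | isWall L i X in wall
        ... | ⊖ | _ = X , τ₋∪τ₌-⊖ X (tope-over X l nz (subst (_≢ 𝟘) (sym Xᵢ) (λ ()))) Xᵢ , refl
        ... | ⊕ | false = X , τ₋∪τ₌-nonwall X (tope-over X l nz (subst (_≢ 𝟘) (sym Xᵢ) (λ ()))) wall , refl
        ... | ⊕ | true = ↑⊖-preimage nz (subst T (sym wall) tt)
        ... | 𝟘 | _ = ↑⊖-preimage nz (subst (T ∘ L) (sym (insertAt-removeAt′ X i Xᵢ)) l)
        surjective : ∀ {Y} → T (topes (deletion L i) Y) → ∃ λ X → T (τ₋∪τ₌ X) × π i X ≡ Y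
        surjective q with tope⁻ (deletion L i) q
        ... | d , nz with deletion⁻ d
        ...   | X , l , refl = preimage-over X l nz

proposition4p12 : ∀ {n} (L : Family (suc n)) (i : Fin (suc n)) →
    IsCOM L → ¬ IsColoop L i →
    (Σ (Elems (τ₊ L i) ⤖ Elems (topes (contraction L i)))
        (λ f → ∀ x → proj₁ (Bijection.to f x) ≡ π i (proj₁ x)))
    × (Σ (Elems (τ₋ L i ∪ᶠ τ₌ L i) ⤖ Elems (topes (deletion L i)))
        (λ f → ∀ x → proj₁ (Bijection.to f x) ≡ π i (proj₁ x)))
    × (card (topes L) ≡ card (topes (deletion L i)) + card (topes (contraction L i)))
proposition4p12 L i com noncoloop =
  bijection τ₊-bij , bijection τ₋∪τ₌-bij , (begin
    card (topes L)              ≡⟨ card-split _ _ _ (ind-tope-split L i) ⟩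
    card (τ₊ L i) + card (τ₋∪τ₌ L i)  ≡⟨ cong₂ _+_ (card≡ τ₊-bij) (card≡ τ₋∪τ₌-bij) ⟩
    card τ'' + card τ'          ≡⟨ +-comm (card τ'') _ ⟩
    card τ' + card τ''          ∎)
  where
  open ≡-Reasoning
  open IsπBijection using (bijection; card≡)
  τ₊-bij = τ₊-bijection L i com noncoloop
  τ₋∪τ₌-bij = τ₋∪τ₌-bijection L i com noncoloop
  τ' τ'' : Family _
  τ' = topes (deletion L i)
  τ'' = topes (contraction L i)
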